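{- Let $G=(V,E)$ be a graph and $k\ge 1$. Let $u,v\in V_{\mathrm{ld}}$ be adjacent, assume neither $u$ nor $v$ is incident to a multi-edge, and assume $N_G(u)\cup\{u\}=N_G(v)\cup\{v\}$. Then for every minimum feasible solution $X$ for $(G,k)$, either $\{u,v\}\subseteq X$ or $\{u,v\}\cap X=\emptyset$.
   Context: Graphs are undirected, without self-loops, possibly with multi-edges. $N(v)$ is the neighbor set; $\rho(v)$ is the number of unordered pairs of neighbors of $v$ that are adjacent (parallel edges counted once). $V_{\mathrm{ld}}$ is the set of vertices $v$ with $|N(v)|>7k$ and $\rho(v)>|N(v)|(|N(v)|-1)/4$. A feasible solution for $(G,k)$ is $X\subseteq V$ with $|X|\le k$ such that every component of $G-X$ is a clique (exactly one edge between any two distinct vertices) or a tree (connected, acyclic, parallel edges forming a cycle); a minimum feasible solution is one of minimum size. -}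

module Defs where

open import Data.Nat using (ℕ; zero; suc; _+_; _*_; _∸_; _≤_; _<_; _≡ᵇ_; _<ᵇ_)
open import Data.Bool using (Bool; true; false; not; _∧_; if_then_else_)
open import Data.Fin using (Fin; toℕ)
open import Data.Fin.Subset using (Subset; _∈_; _∉_; ∣_∣)
open import Data.List using (List; []; _∷_; length)
open import Data.List.Relation.Unary.Unique.Propositional using (Unique)
open import Data.List.Relation.Unary.All using (All)
open import Data.Product using (_×_; Σ)
open import Data.Sum using (_⊎_)
open import Relation.Binary.PropositionalEquality using (_≡_; _≢_)
open import Relation.Nullary using (¬_)
open import Data.Empty using (⊥)

-- A finite multigraph on vertex set Fin n: mult u v = number of edges between u and v.
record Graph : Set where
  field
    n     : ℕ
    mult  : Fin n → Fin n → ℕ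
    sym   : ∀ u v → mult u v ≡ mult v u
    loopless : ∀ v → mult v v ≡ 0
open Graph public

Adj : (G : Graph) → Fin (n G) → Fin (n G) → Set
Adj G u v = 1 ≤ mult G u v

adjᵇ : (G : Graph) → Fin (n G) → Fin (n G) → Bool
adjᵇ G u v = not (mult G u v ≡ᵇ 0)

countF : ∀ {m} → (Fin m → Bool) → ℕ
countF {zero} f = 0
countF {suc m} f = (if f Fin.zero then 1 else 0) + countF (λ i → f (Fin.suc i))

sumF : ∀ {m} → (Fin m → ℕ) → ℕ
sumF {zero} f = 0
sumF {suc m} f = f Fin.zero + sumF (λ i → f (Fin.suc i))

deg : (G : Graph) → Fin (n G) → ℕ
deg G v = countF (adjᵇ G v)

-- ρ(v): unordered pairs {a,b} (a < b) of neighbours of v that are adjacent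
ρ : (G : Graph) → Fin (n G) → ℕ
ρ G v = sumF (λ a → countF (λ b →
          (toℕ a <ᵇ toℕ b) ∧ adjᵇ G v a ∧ adjᵇ G v b ∧ adjᵇ G a b))

-- v ∈ V_ld :  |N(v)| > 7k  and  ρ(v) > |N(v)|(|N(v)|-1)/4  (written as 4ρ > d(d-1))
InVld : (G : Graph) → ℕ → Fin (n G) → Set
InVld G k v = (7 * k < deg G v) × (deg G v * (deg G v ∸ 1) < 4 * ρ G v)

NoMultiEdge : (G : Graph) → Fin (n G) → Set
NoMultiEdge G v = ∀ w → mult G v w ≤ 1

data Reach (G : Graph) (X : Subset (n G)) : Fin (n G) → Fin (n G) → Set where
  here : ∀ {x} → x ∉ X → Reach G X x x
  step : ∀ {x y z} → Reach G X x y → z ∉ X → Adj G y z → Reach G X x z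

data Path (G : Graph) : List (Fin (n G)) → Set where
  one  : ∀ {a} → Path G (a ∷ [])
  cons : ∀ {a b l} → Adj G a b → Path G (b ∷ l) → Path G (a ∷ b ∷ l)

last′ : ∀ {A : Set} → A → List A → A
last′ a [] = a
last′ a (b ∷ l) = last′ b l

CycleIn : (G : Graph) (X : Subset (n G)) (x : Fin (n G)) → List (Fin (n G)) → Set
CycleIn G X x [] = ⊥
CycleIn G X x (a ∷ l) =
  (3 ≤ length (a ∷ l)) × Unique (a ∷ l) × All (Reach G X x) (a ∷ l)
  × Path G (a ∷ l) × Adj G (last′ a l) a

CompClique : (G : Graph) (X : Subset (n G)) → Fin (n G) → Set
CompClique G X x = ∀ y z → Reach G X x y → Reach G X x z → y ≢ z → mult G y z ≡ 1

-- the component of x in G - X is a tree: (connected by construction) and acyclic,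
-- where parallel edges form a cycle
CompTree : (G : Graph) (X : Subset (n G)) → Fin (n G) → Set
CompTree G X x =
  (∀ y z → Reach G X x y → Reach G X x z → mult G y z ≤ 1)
  × (∀ c → ¬ CycleIn G X x c)

Feasible : (G : Graph) → ℕ → Subset (n G) → Set
Feasible G k X = (∣ X ∣ ≤ k)
  × (∀ x → x ∉ X → CompClique G X x ⊎ CompTree G X x)

MinFeasible : (G : Graph) → ℕ → Subset (n G) → Set
MinFeasible G k X = Feasible G k X × (∀ Y → Feasible G k Y → ∣ X ∣ ≤ ∣ Y ∣)

{-# OPTIONS --safe #-}
-- Suppose u ∈ X and v ∉ X, and let C be the component of v in G - X.
-- If C is a clique, then so is C ∪ {u}, because u is a closed twin of v
-- with simple edges; hence X - u is a smaller feasible solution.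
-- If C is a tree, then no two neighbours of v outside X are adjacent, so
-- every adjacent pair of neighbours of v meets X.  Each x ∈ X lies in at
-- most deg v such pairs, so ρ(v) ≤ |X| deg v ≤ k deg v, and 7k < deg v
-- gives 4ρ(v) ≤ deg v (deg v - 1), contradicting v ∈ V_ld.
module Submission where

open import Defs renaming (sym to mult-sym)
open import Data.Bool using (Bool; true; false; _∧_; _∨_; if_then_else_; T)
open import Data.Bool.Properties using (T-∨; T-≡)
open import Data.Empty using (⊥; ⊥-elim)
open import Data.Fin using (Fin; toℕ) renaming (_≟_ to _≟ᶠ_)
open import Data.Fin.Properties using (∀-cons; <⇒≢)
open import Data.Fin.Subset using (Subset; _∈_; _∉_; ∣_∣; _-_; ⁅_⁆)
open import Data.Fin.Subset.Properties
  using (_∈?_; x∈p∧x≢y⇒x∈p-y; p─q⊆p; ∣p─q∣≤∣p∣; x∈p⇒∣p-x∣<∣p∣)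
open import Data.List using ([]; _∷_)
open import Data.List.Relation.Unary.All as All using ([]; _∷_)
open import Data.List.Relation.Unary.AllPairs using ([]; _∷_)
open import Data.Nat using (ℕ; zero; suc; _+_; _*_; _∸_; _≤_; _<_; _<ᵇ_; z≤n; s≤s; >-nonZero⁻¹)
open import Data.Nat.Properties
  using ( +-*-semiring; +-mono-≤; +-identityʳ; *-assoc; *-comm; *-distribˡ-+; *-monoˡ-≤; *-monoʳ-≤
        ; ≤-refl; ≤-reflexive; ≤-antisym; ≤-trans; ≤-pred; ≤-<-trans; <-irrefl; <-asym; <⇒≱; <ᵇ⇒<
        ; module ≤-Reasoning )
open import Algebra.Properties.Semiring.Sum +-*-semiring
  using (sum; sum-syntax; ∑-comm; ∑-distrib-+; *-distribˡ-sum; *-distribʳ-sum; sum-cong-≗)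
open import Data.Product using (_×_; _,_; proj₁; proj₂)
open import Data.Sum using (_⊎_; inj₁; inj₂; [_,_])
open import Data.Unit using (tt)
open import Data.Vec using (_∷_; []; lookup)
open import Data.Vec.Properties using ([]=⇒lookup)
open import Function.Base using (_∘_)
open import Function.Bundles using (_⇔_; Equivalence)
open import Function.Properties.Equivalence using () renaming (sym to ⇔-sym)
open import Relation.Binary.PropositionalEquality
  using (_≡_; _≢_; refl; sym; trans; cong; cong₂; subst; module ≡-Reasoning)
open import Relation.Nullary using (¬_; Dec; yes; no)
open import Relation.Nullary.Decidable using (¬¬-excluded-middle)
open import Relation.Nullary.Negation using (¬¬-map)

𝟙 : Bool → ℕ
𝟙 b = if b then 1 else 0

sumF≡sum : ∀ {m} (f : Fin m → ℕ) → sumF f ≡ sum f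
sumF≡sum {zero}  f = refl
sumF≡sum {suc m} f = cong (f Fin.zero +_) (sumF≡sum (λ i → f (Fin.suc i)))

countF≡∑𝟙 : ∀ {m} (p : Fin m → Bool) → countF p ≡ ∑[ i < m ] 𝟙 (p i)
countF≡∑𝟙 {zero}  p = refl
countF≡∑𝟙 {suc m} p = cong (𝟙 (p Fin.zero) +_) (countF≡∑𝟙 (λ i → p (Fin.suc i)))

∣p∣≡countF : ∀ {m} (p : Subset m) → ∣ p ∣ ≡ countF (lookup p)
∣p∣≡countF []          = refl
∣p∣≡countF (true ∷ p)  = cong suc (∣p∣≡countF p)
∣p∣≡countF (false ∷ p) = ∣p∣≡countF p

sum-mono-≤ : ∀ {m} {f g : Fin m → ℕ} → (∀ i → f i ≤ g i) → sum f ≤ sum g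
sum-mono-≤ {zero}  f≤g = z≤n
sum-mono-≤ {suc m} f≤g = +-mono-≤ (f≤g Fin.zero) (sum-mono-≤ (λ i → f≤g (Fin.suc i)))

∑∑-+-transposeʳ : ∀ {m} (f g : Fin m → Fin m → ℕ) →
  ∑[ i < m ] ∑[ j < m ] (f i j + g i j) ≡ ∑[ i < m ] ∑[ j < m ] (f i j + g j i)
∑∑-+-transposeʳ {m} f g = begin
  ∑[ i < m ] ∑[ j < m ] (f i j + g i j)
    ≡⟨ sum-cong-≗ (λ i → ∑-distrib-+ (f i) (g i)) ⟩
  ∑[ i < m ] (∑[ j < m ] f i j + ∑[ j < m ] g i j)
    ≡⟨ ∑-distrib-+ (λ i → sum (f i)) (λ i → sum (g i)) ⟩
  ∑[ i < m ] ∑[ j < m ] f i j + ∑[ i < m ] ∑[ j < m ] g i j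
    ≡⟨ cong (∑[ i < m ] ∑[ j < m ] f i j +_) (∑-comm g) ⟩
  ∑[ i < m ] ∑[ j < m ] f i j + ∑[ j < m ] ∑[ i < m ] g i j
    ≡⟨ ∑-distrib-+ (λ i → sum (f i)) (λ i → ∑[ j < m ] g j i) ⟨
  ∑[ i < m ] (∑[ j < m ] f i j + ∑[ j < m ] g j i)
    ≡⟨ sum-cong-≗ (λ i → ∑-distrib-+ (f i) (λ j → g j i)) ⟨
  ∑[ i < m ] ∑[ j < m ] (f i j + g j i)
    ∎
  where open ≡-Reasoning

𝟙-before+after≤ : ∀ x y b → 𝟙 ((x <ᵇ y) ∧ b) + 𝟙 ((y <ᵇ x) ∧ b) ≤ 𝟙 b
𝟙-before+after≤ x y b with x <ᵇ y | y <ᵇ x | <ᵇ⇒< x y | <ᵇ⇒< y x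
... | true  | true  | x<y | y<x = ⊥-elim (<-asym (x<y tt) (y<x tt))
... | true  | false | _   | _   = ≤-reflexive (+-identityʳ (𝟙 b))
... | false | true  | _   | _   = ≤-refl
... | false | false | _   | _   = z≤n

module _ {m : ℕ} (S N : Fin m → Bool) (E : Fin m → Fin m → Bool) where

  private
    _≺_ : Fin m → Fin m → Bool
    a ≺ b = toℕ a <ᵇ toℕ b

  VertexCoverOn : Set
  VertexCoverOn = ∀ a b → T ((a ≺ b) ∧ N a ∧ N b ∧ E a b) → T (S a ∨ S b)

  -- Charge each pair to an endpoint in S; the other endpoint is an N-element
  -- before or after it, and the order a ≺ b keeps each pair charged only once.
  edgesOn≤∣cover∣*∣N∣ : VertexCoverOn →
    sumF (λ a → countF (λ b → (a ≺ b) ∧ N a ∧ N b ∧ E a b)) ≤ countF S * countF N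
  edgesOn≤∣cover∣*∣N∣ covered = begin
    sumF (λ a → countF (pair a))
      ≡⟨ trans (sumF≡sum (λ a → countF (pair a))) (sum-cong-≗ (λ a → countF≡∑𝟙 (pair a))) ⟩
    ∑[ a < m ] ∑[ b < m ] 𝟙 (pair a b)
      ≤⟨ sum-mono-≤ (λ a → sum-mono-≤ (charge a)) ⟩
    ∑[ a < m ] ∑[ b < m ] (𝟙 (S a) * after a b + 𝟙 (S b) * before b a)
      ≡⟨ ∑∑-+-transposeʳ (λ a b → 𝟙 (S a) * after a b) (λ a b → 𝟙 (S b) * before b a) ⟩
    ∑[ a < m ] ∑[ b < m ] (𝟙 (S a) * after a b + 𝟙 (S a) * before a b)
      ≡⟨ sum-cong-≗ (λ a → trans
           (sum-cong-≗ (λ b → sym (*-distribˡ-+ (𝟙 (S a)) (after a b) (before a b))))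
           (sym (*-distribˡ-sum (𝟙 (S a)) (λ b → after a b + before a b)))) ⟩
    ∑[ a < m ] (𝟙 (S a) * ∑[ b < m ] (after a b + before a b))
      ≤⟨ sum-mono-≤ (λ a → *-monoʳ-≤ (𝟙 (S a))
           (sum-mono-≤ (λ b → 𝟙-before+after≤ (toℕ a) (toℕ b) (N b)))) ⟩
    ∑[ a < m ] (𝟙 (S a) * ∑[ b < m ] 𝟙 (N b))
      ≡⟨ *-distribʳ-sum (∑[ b < m ] 𝟙 (N b)) (λ a → 𝟙 (S a)) ⟨
    (∑[ a < m ] 𝟙 (S a)) * ∑[ b < m ] 𝟙 (N b)
      ≡⟨ cong₂ _*_ (countF≡∑𝟙 S) (countF≡∑𝟙 N) ⟨
    countF S * countF N ∎
    where
    open ≤-Reasoning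
    pair : Fin m → Fin m → Bool
    pair a b = (a ≺ b) ∧ N a ∧ N b ∧ E a b
    after before : Fin m → Fin m → ℕ
    after a b = 𝟙 ((a ≺ b) ∧ N b)
    before a b = 𝟙 ((b ≺ a) ∧ N b)
    charge : ∀ a b → 𝟙 (pair a b) ≤ 𝟙 (S a) * after a b + 𝟙 (S b) * before b a
    charge a b with a ≺ b | N a | N b | E a b | S a | S b | covered a b
    ... | false | _     | _     | _     | _     | _     | _      = z≤n
    ... | true  | false | _     | _     | _     | _     | _      = z≤n
    ... | true  | true  | false | _     | _     | _     | _      = z≤n
    ... | true  | true  | true  | false | _     | _     | _      = z≤n
    ... | true  | true  | true  | true  | true  | _     | _      = s≤s z≤n
    ... | true  | true  | true  | true  | false | true  | _      = s≤s z≤n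
    ... | true  | true  | true  | true  | false | false | covers = ⊥-elim (covers tt)

T-∧⁴ : ∀ w x y z → T (w ∧ x ∧ y ∧ z) → T w × T x × T y × T z
T-∧⁴ true  true  true  true  _  = _
T-∧⁴ false _     _     _     ()
T-∧⁴ true  false _     _     ()
T-∧⁴ true  true  false _     ()
T-∧⁴ true  true  true  false ()

¬¬-∀-Fin : ∀ {m} {P : Fin m → Set} → (∀ i → ¬ ¬ P i) → ¬ ¬ (∀ i → P i)
¬¬-∀-Fin {zero}  _ k = k (λ ())
¬¬-∀-Fin {suc m} h k = h Fin.zero (λ p₀ → ¬¬-∀-Fin (λ i → h (Fin.suc i)) (λ ps → k (∀-cons p₀ ps)))

∈⇒T-lookup : ∀ {m} {p : Subset m} {x} → x ∈ p → T (lookup p x)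
∈⇒T-lookup x∈p = Equivalence.from T-≡ ([]=⇒lookup x∈p)

7*s<d⇒4*[s*d]≤d*[d∸1] : ∀ {s d} → 7 * s < d → 4 * (s * d) ≤ d * (d ∸ 1)
7*s<d⇒4*[s*d]≤d*[d∸1] {s} {suc d} 7s<1+d = begin
  4 * (s * suc d) ≡⟨ *-assoc 4 s (suc d) ⟨
  4 * s * suc d   ≤⟨ *-monoˡ-≤ (suc d) 4s≤d ⟩
  d * suc d       ≡⟨ *-comm d (suc d) ⟩
  suc d * d       ∎
  where
  open ≤-Reasoning
  4s≤d : 4 * s ≤ d
  4s≤d = ≤-trans (*-monoˡ-≤ s {4} {7} (s≤s (s≤s (s≤s (s≤s z≤n))))) (≤-pred 7s<1+d)

module _ (G : Graph) where

  Adj-sym : ∀ {a b} → Adj G a b → Adj G b a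
  Adj-sym {a} {b} = subst (1 ≤_) (mult-sym G a b)

  Adj⇒≢ : ∀ {a b} → Adj G a b → a ≢ b
  Adj⇒≢ {a} a~a refl = <-irrefl (sym (loopless G a)) a~a

  T-adjᵇ⇒Adj : ∀ {a b} → T (adjᵇ G a b) → Adj G a b
  T-adjᵇ⇒Adj {a} {b} t = >-nonZero⁻¹ (mult G a b) {{record { nonZero = t }}}

Reach⇒∉ : ∀ {G X x y} → Reach G X x y → y ∉ X
Reach⇒∉ (here y∉X)     = y∉X
Reach⇒∉ (step _ y∉X _) = y∉X

module _ {G : Graph} {X : Subset (n G)} {v : Fin (n G)} (v∉X : v ∉ X) (tree : CompTree G X v) where

  tree-triangle-free : ∀ {a b} → a ∉ X → b ∉ X → Adj G v a → Adj G v b → Adj G a b → a ≢ b → ⊥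
  tree-triangle-free {a} {b} a∉X b∉X v~a v~b a~b a≢b = proj₂ tree (v ∷ a ∷ b ∷ [])
    ( s≤s (s≤s (s≤s z≤n))
    , (Adj⇒≢ G v~a ∷ Adj⇒≢ G v~b ∷ []) ∷ (a≢b ∷ []) ∷ [] ∷ []
    , here v∉X ∷ step (here v∉X) a∉X v~a ∷ step (here v∉X) b∉X v~b ∷ []
    , cons v~a (cons a~b one)
    , Adj-sym G v~b )

  X-covers-neighbourhood : VertexCoverOn (lookup X) (adjᵇ G v) (adjᵇ G)
  X-covers-neighbourhood a b pair with a ∈? X | b ∈? X
  ... | yes a∈X | _       = Equivalence.from T-∨ (inj₁ (∈⇒T-lookup a∈X))
  ... | no _    | yes b∈X = Equivalence.from T-∨ (inj₂ (∈⇒T-lookup b∈X))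
  ... | no a∉X  | no b∉X  with T-∧⁴ _ _ _ _ pair
  ...   | a<b , v~a , v~b , a~b = ⊥-elim (tree-triangle-free a∉X b∉X
          (T-adjᵇ⇒Adj G v~a) (T-adjᵇ⇒Adj G v~b) (T-adjᵇ⇒Adj G a~b) (<⇒≢ (<ᵇ⇒< _ _ a<b)))

  ρ≤∣X∣*deg : ρ G v ≤ ∣ X ∣ * deg G v
  ρ≤∣X∣*deg = subst (λ s → ρ G v ≤ s * deg G v) (sym (∣p∣≡countF X))
    (edgesOn≤∣cover∣*∣N∣ (lookup X) (adjᵇ G v) (adjᵇ G) X-covers-neighbourhood)

ld-component-not-tree : ∀ {G k X v} → ∣ X ∣ ≤ k → InVld G k v → v ∉ X → ¬ CompTree G X v
ld-component-not-tree {G} {k} {X} {v} ∣X∣≤k (7k<d , dense) v∉X tree = <⇒≱ dense (begin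
  4 * ρ G v               ≤⟨ *-monoʳ-≤ 4 (ρ≤∣X∣*deg v∉X tree) ⟩
  4 * (∣ X ∣ * deg G v)   ≤⟨ 7*s<d⇒4*[s*d]≤d*[d∸1] {∣ X ∣} (≤-<-trans (*-monoʳ-≤ 7 ∣X∣≤k) 7k<d) ⟩
  deg G v * (deg G v ∸ 1) ∎)
  where open ≤-Reasoning

-- N(u) ⊆ N[v]; for adjacent u and v this is N[u] ⊆ N[v].
ClosedNbhd⊆ : (G : Graph) → Fin (n G) → Fin (n G) → Set
ClosedNbhd⊆ G u v = ∀ w → Adj G u w → w ≡ v ⊎ Adj G v w

module TwinMerge {G : Graph} {X : Subset (n G)} {u v : Fin (n G)}
  (v∉X : v ∉ X) (u⊑v : ClosedNbhd⊆ G u v) where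

  Merged : Fin (n G) → Set
  Merged w = w ≡ u ⊎ Reach G X v w

  ∉X-u⇒∉X : ∀ {z} → z ∉ X - u → z ≢ u → z ∉ X
  ∉X-u⇒∉X z∉X-u z≢u z∈X = z∉X-u (x∈p∧x≢y⇒x∈p-y z∈X z≢u)

  Merged-closed : ∀ {w z} → Merged w → z ∉ X - u → Adj G w z → Merged z
  Merged-closed (inj₁ refl) z∉X-u u~z with u⊑v _ u~z
  ... | inj₁ refl = inj₂ (here v∉X)
  ... | inj₂ v~z  = inj₂ (step (here v∉X) (∉X-u⇒∉X z∉X-u (Adj⇒≢ G u~z ∘ sym)) v~z)
  Merged-closed {z = z} (inj₂ v⇝w) z∉X-u w~z with z ≟ᶠ u
  ... | yes z≡u = inj₁ z≡u
  ... | no z≢u  = inj₂ (step v⇝w (∉X-u⇒∉X z∉X-u z≢u) w~z)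

  Reach-Merged : ∀ {x y} → Merged x → Reach G (X - u) x y → Merged y
  Reach-Merged merged (here _)             = merged
  Reach-Merged merged (step x⇝y z∉X-u y~z) = Merged-closed (Reach-Merged merged x⇝y) z∉X-u y~z

  Reach-unmerged : ∀ {x y} → ¬ Merged x → Reach G (X - u) x y → Reach G X x y × ¬ Merged y
  Reach-unmerged unmerged (here x∉X-u) = here (∉X-u⇒∉X x∉X-u (unmerged ∘ inj₁)) , unmerged
  Reach-unmerged unmerged (step {y = y} {z} x⇝y z∉X-u y~z)
    with Reach-unmerged unmerged x⇝y
  ... | x⇝y-in-X , y-unmerged = step x⇝y-in-X (∉X-u⇒∉X z∉X-u (z-unmerged ∘ inj₁)) y~z , z-unmerged
    where
    y∉X-u : y ∉ X - u
    y∉X-u y∈X-u = Reach⇒∉ x⇝y-in-X (p─q⊆p X ⁅ u ⁆ y∈X-u)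
    z-unmerged : ¬ Merged z
    z-unmerged z-merged = y-unmerged (Merged-closed z-merged y∉X-u (Adj-sym G y~z))

  unmerged-Reach : ∀ {x y} → ¬ Merged x → Reach G (X - u) x y → Reach G X x y
  unmerged-Reach unmerged = proj₁ ∘ Reach-unmerged unmerged

  unmerged-CycleIn : ∀ {x} → ¬ Merged x → ∀ c → CycleIn G (X - u) x c → CycleIn G X x c
  unmerged-CycleIn unmerged (a ∷ l) (long , distinct , reachable , path , closed) =
    long , distinct , All.map (unmerged-Reach unmerged) reachable , path , closed

  unmerged-component : ∀ {x} → ¬ Merged x
    → CompClique G X x ⊎ CompTree G X x → CompClique G (X - u) x ⊎ CompTree G (X - u) x
  unmerged-component unmerged (inj₁ clique) =
    inj₁ (λ y z x⇝y x⇝z → clique y z (unmerged-Reach unmerged x⇝y) (unmerged-Reach unmerged x⇝z))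
  unmerged-component unmerged (inj₂ (simple , acyclic)) =
    inj₂ ( (λ y z x⇝y x⇝z → simple y z (unmerged-Reach unmerged x⇝y) (unmerged-Reach unmerged x⇝z))
         , (λ c cycle → acyclic c (unmerged-CycleIn unmerged c cycle)) )

  module _ (u∈X : u ∈ X) (u~v : Adj G u v) (simple-u : NoMultiEdge G u)
           (v⊑u : ClosedNbhd⊆ G v u) (clique : CompClique G X v) where

    Adj-u : ∀ {z} → Reach G X v z → Adj G u z
    Adj-u {z} v⇝z with z ≟ᶠ v
    ... | yes refl = u~v
    ... | no z≢v with v⊑u z (≤-reflexive (sym (clique v z (here v∉X) v⇝z (z≢v ∘ sym))))
    ...   | inj₁ refl = ⊥-elim (Reach⇒∉ v⇝z u∈X)
    ...   | inj₂ u~z  = u~z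

    Merged-clique : ∀ {y z} → Merged y → Merged z → y ≢ z → mult G y z ≡ 1
    Merged-clique (inj₁ refl) (inj₁ refl) u≢u = ⊥-elim (u≢u refl)
    Merged-clique (inj₁ refl) (inj₂ v⇝z)  _   = ≤-antisym (simple-u _) (Adj-u v⇝z)
    Merged-clique {y} (inj₂ v⇝y) (inj₁ refl) _ =
      trans (mult-sym G y u) (≤-antisym (simple-u _) (Adj-u v⇝y))
    Merged-clique {y} {z} (inj₂ v⇝y) (inj₂ v⇝z) = clique y z v⇝y v⇝z

    -- Membership in Merged is not decidable here, so feasibility of X - u is
    -- obtained only under double negation; that suffices to refute minimality.
    merged-feasible : ∀ {k} → Feasible G k X → ¬ ¬ Feasible G k (X - u)
    merged-feasible (∣X∣≤k , components) =
      ¬¬-map (≤-trans (∣p─q∣≤∣p∣ X ⁅ u ⁆) ∣X∣≤k ,_)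
             (¬¬-∀-Fin (λ x → ¬¬-map (component x) ¬¬-excluded-middle))
      where
      component : ∀ x → Dec (Merged x) → x ∉ X - u → CompClique G (X - u) x ⊎ CompTree G (X - u) x
      component x (yes merged) _ =
        inj₁ (λ y z x⇝y x⇝z → Merged-clique (Reach-Merged merged x⇝y) (Reach-Merged merged x⇝z))
      component x (no unmerged) x∉X-u =
        unmerged-component unmerged (components x (∉X-u⇒∉X x∉X-u (unmerged ∘ inj₁)))

ClosedTwins : (G : Graph) → Fin (n G) → Fin (n G) → Set
ClosedTwins G u v = ∀ w → ((w ≡ u) ⊎ Adj G u w) ⇔ ((w ≡ v) ⊎ Adj G v w)

ClosedTwins-sym : ∀ {G u v} → ClosedTwins G u v → ClosedTwins G v u
ClosedTwins-sym twins w = ⇔-sym (twins w)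

ld-twins-not-split : ∀ {G k X u v} → MinFeasible G k X → InVld G k v → Adj G u v
  → NoMultiEdge G u → ClosedTwins G u v → u ∈ X → v ∉ X → ⊥
ld-twins-not-split {G} {k} {X} {u} {v}
  ((∣X∣≤k , components) , minimal) ld-v u~v simple-u twins u∈X v∉X =
  [ not-clique , ld-component-not-tree ∣X∣≤k ld-v v∉X ] (components v v∉X)
  where
  u⊑v : ClosedNbhd⊆ G u v
  u⊑v w = Equivalence.to (twins w) ∘ inj₂
  v⊑u : ClosedNbhd⊆ G v u
  v⊑u w = Equivalence.from (twins w) ∘ inj₂
  X-u-infeasible : ¬ Feasible G k (X - u)
  X-u-infeasible feasible = <⇒≱ (x∈p⇒∣p-x∣<∣p∣ u∈X) (minimal (X - u) feasible)
  not-clique : ¬ CompClique G X v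
  not-clique clique =
    TwinMerge.merged-feasible v∉X u⊑v u∈X u~v simple-u v⊑u clique (∣X∣≤k , components)
      X-u-infeasible

lemma20 : (G : Graph) (k : ℕ) → 1 ≤ k → (u v : Fin (n G))
    → InVld G k u → InVld G k v → Adj G u v
    → NoMultiEdge G u → NoMultiEdge G v
    → (∀ w → ((w ≡ u) ⊎ Adj G u w) ⇔ ((w ≡ v) ⊎ Adj G v w))
    → (X : Subset (n G)) → MinFeasible G k X
    → ((u ∈ X) × (v ∈ X)) ⊎ ((u ∉ X) × (v ∉ X))
lemma20 G k _ u v ld-u ld-v u~v simple-u simple-v twins X minimum with u ∈? X | v ∈? X
... | yes u∈X | yes v∈X = inj₁ (u∈X , v∈X)
... | no u∉X  | no v∉X  = inj₂ (u∉X , v∉X)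
... | yes u∈X | no v∉X  = ⊥-elim (ld-twins-not-split minimum ld-v u~v simple-u twins u∈X v∉X)
... | no u∉X  | yes v∈X =
  ⊥-elim (ld-twins-not-split minimum ld-u (Adj-sym G u~v) simple-v
    (ClosedTwins-sym {G} {u} {v} twins) v∈X u∉X)
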